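{- Let $G$ be a tree-path intersection graph. Two edges of $G$ are $r$-independent if and only if there does not exist an $r$-guard $e\in E(G)$ which covers both edges.
   Context: A tree-path intersection graph is a connected bipartite graph $G$ with disjoint parts $G_H$, $G_V$, together with a tree $T_H$ on vertex set $G_H$ and a tree $T_V$ on vertex set $G_V$, such that for every $h\in G_H$ the neighbourhood $\Gamma(h)$ of $h$ in $G$ is the vertex set of a path in $T_V$, and for every $v\in G_V$ the neighbourhood $\Gamma(v)$ is the vertex set of a path in $T_H$. For $h\in G_H$, $v\in G_V$ write $hv$ for $\{h,v\}$. An $r$-guard is an edge $hv\in E(G)$; it covers an edge $h'v'\in E(G)$ if $hv'\in E(G)$ and $h'v\in E(G)$. Two edges $h_1v_1,h_2v_2\in E(G)$ are $r$-independent if $\Gamma(h_1)\cap\Gamma(h_2)=\emptyset$ or $\Gamma(v_1)\cap\Gamma(v_2)=\emptyset$. -}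

module Defs where

open import Data.Nat using (ℕ; _≤_)
open import Data.Fin using (Fin)
open import Data.Bool using (Bool; false; T)
open import Data.Empty using (⊥)
open import Data.List using (List; []; _∷_; length; _∷ʳ_)
open import Data.List.Relation.Unary.Linked using (Linked)
open import Data.List.Relation.Unary.Unique.Propositional using (Unique)
open import Data.List.Membership.Propositional using (_∈_)
open import Data.Product using (Σ; ∃; _×_)
open import Data.Sum using (_⊎_; inj₁; inj₂)
open import Relation.Nullary using (¬_)
open import Relation.Binary.PropositionalEquality using (_≡_)

data Walk {A : Set} (R : A → A → Set) : A → A → Set where
  here : ∀ {x} → Walk R x x
  step : ∀ {x y z} → R x y → Walk R y z → Walk R x z

Connected : {A : Set} → (A → A → Set) → Set
Connected {A} R = (x y : A) → Walk R x y

IsPath : {A : Set} → (A → A → Set) → List A → Set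
IsPath R []       = ⊥
IsPath R (x ∷ xs) = Linked R (x ∷ xs) × Unique (x ∷ xs)

IsCycle : {A : Set} → (A → A → Set) → List A → Set
IsCycle R []       = ⊥
IsCycle R (x ∷ xs) = (3 ≤ length (x ∷ xs)) × Unique (x ∷ xs) × Linked R ((x ∷ xs) ∷ʳ x)

Adj : {k : ℕ} → (Fin k → Fin k → Bool) → Fin k → Fin k → Set
Adj a x y = T (a x y)

record IsTree {k : ℕ} (a : Fin k → Fin k → Bool) : Set where
  field
    symmetric   : ∀ x y → a x y ≡ a y x
    irreflexive : ∀ x → a x x ≡ false
    connected   : Connected (Adj a)
    acyclic     : ∀ p → ¬ IsCycle (Adj a) p

IsVertexSetOf : {A : Set} → (A → Set) → List A → Set
IsVertexSetOf {A} S p = ∀ x → (S x → x ∈ p) × (x ∈ p → S x)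

-- Tree-path intersection graphs.
-- G_H = Fin m, G_V = Fin n (disjoint parts), E h v : Bool says hv ∈ E(G).

BipAdj : {m n : ℕ} → (Fin m → Fin n → Bool) → Fin m ⊎ Fin n → Fin m ⊎ Fin n → Set
BipAdj E (inj₁ h) (inj₁ h′) = ⊥
BipAdj E (inj₁ h) (inj₂ v)  = T (E h v)
BipAdj E (inj₂ v) (inj₁ h)  = T (E h v)
BipAdj E (inj₂ v) (inj₂ v′) = ⊥

record TPIG : Set where
  field
    m n : ℕ
    E   : Fin m → Fin n → Bool
    TH  : Fin m → Fin m → Bool
    TV  : Fin n → Fin n → Bool
    G-connected : Connected (BipAdj E)
    TH-tree : IsTree TH
    TV-tree : IsTree TV
    ΓH-path : ∀ h → Σ (List (Fin n)) λ p → IsPath (Adj TV) p × IsVertexSetOf (λ v → T (E h v)) p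
    ΓV-path : ∀ v → Σ (List (Fin m)) λ p → IsPath (Adj TH) p × IsVertexSetOf (λ h → T (E h v)) p

module _ (G : TPIG) where
  open TPIG G

  Edge : Fin m → Fin n → Set
  Edge h v = T (E h v)

  Covers : Fin m → Fin n → Fin m → Fin n → Set
  Covers h v h′ v′ = Edge h v′ × Edge h′ v

  RIndependent : Fin m → Fin n → Fin m → Fin n → Set
  RIndependent h₁ v₁ h₂ v₂ =
    (¬ ∃ λ v → Edge h₁ v × Edge h₂ v) ⊎ (¬ ∃ λ h → Edge h v₁ × Edge h v₂)

  CommonGuard : Fin m → Fin n → Fin m → Fin n → Set
  CommonGuard h₁ v₁ h₂ v₂ =
    ∃ λ h → ∃ λ v → Edge h v × Covers h v h₁ v₁ × Covers h v h₂ v₂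

-- If v₀ ∈ Γ(h₁) ∩ Γ(h₂) and h₀ ∈ Γ(v₁) ∩ Γ(v₂), the paths Γ(h₀), Γ(h₁), Γ(h₂) of the tree T_V
-- meet pairwise (in v₁, v₀, v₂), so by the Helly property of paths in a tree they share a vertex t,
-- and the guard h₀t covers both edges; the other direction is immediate.
-- Helly: walk inside Γ(h₂) from v₀ towards v₂ up to the first vertex t of Γ(h₀), then inside Γ(h₀)
-- to v₁. In a forest any two simple walks with the same ends have the same vertices (else the second
-- vertex of one, followed by a detour until it meets the other, closes a cycle), so t ∈ Γ(h₁).
module Submission where

open import Defs
open import Data.Fin using (Fin; _≟_)
open import Data.Fin.Properties using (any?)
open import Data.Bool using (T; T?)
open import Data.Empty using (⊥-elim)
open import Data.Nat using (suc; _≤_; s≤s; z≤n)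
open import Data.Nat.Properties using (≤-refl; m≤n⇒m≤1+n; module ≤-Reasoning)
open import Data.List using (List; []; _∷_; _++_; _∷ʳ_; length; reverse)
open import Data.List.Properties using (++-assoc; unfold-reverse)
open import Data.List.Membership.Propositional using (_∈_; _∉_; lose)
open import Data.List.Membership.Propositional.Properties using (∈-++⁻)
import Data.List.Membership.DecPropositional as DecMembership
open import Data.List.Relation.Binary.Subset.Propositional using (_⊆_)
open import Data.List.Relation.Binary.Disjoint.Propositional using (Disjoint)
import Data.List.Relation.Binary.Permutation.Setoid as Permutation
import Data.List.Relation.Binary.Permutation.Setoid.Properties as PermutationProperties
open import Data.List.Relation.Unary.All as All using (All; []; _∷_)
open import Data.List.Relation.Unary.All.Properties using (anti-mono)
open import Data.List.Relation.Unary.Any as Any using (Any; here; there)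
open import Data.List.Relation.Unary.AllPairs using ([]; _∷_)
open import Data.List.Relation.Unary.Linked using (Linked; [-]; _∷_)
open import Data.List.Relation.Unary.Unique.Propositional using (Unique)
open import Data.List.Relation.Unary.Unique.Propositional.Properties using (++⁺)
open import Data.Product using (Σ; ∃; _×_; _,_; proj₁; proj₂)
open import Data.Sum using (_⊎_; inj₁; inj₂; [_,_]′)
open import Function using (id; _∘_)
open import Relation.Binary.Definitions using (DecidableEquality; Symmetric)
open import Relation.Binary.PropositionalEquality using (_≡_; refl; sym; cong; subst; module ≡-Reasoning)
open import Relation.Binary.PropositionalEquality.Properties using (setoid)
open import Relation.Nullary using (¬_; yes; no)
open import Relation.Nullary.Decidable using (_×-dec_)
open import Relation.Unary using (Decidable)

module Walks {A : Set} {R : A → A → Set} where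

  open Permutation (setoid A) using (_↭_; ↭-reflexive; ↭-sym; ↭-trans)
  open PermutationProperties (setoid A) using (↭-reverse; ∷↭∷ʳ; Unique-resp-↭; ∈-resp-↭; xs↭ys⇒|xs|≡|ys|)

  vertices : ∀ {x y} → Walk R x y → List A
  vertices {x} here       = x ∷ []
  vertices {x} (step _ w) = x ∷ vertices w

  sources : ∀ {x y} → Walk R x y → List A
  sources here           = []
  sources {x} (step _ w) = x ∷ sources w

  _++ʷ_ : ∀ {x y z} → Walk R x y → Walk R y z → Walk R x z
  here     ++ʷ q = q
  step r p ++ʷ q = step r (p ++ʷ q)

  vertices-++ʷ : ∀ {x y z} (p : Walk R x y) (q : Walk R y z) →
                 vertices (p ++ʷ q) ≡ sources p ++ vertices q
  vertices-++ʷ here       q = refl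
  vertices-++ʷ (step r p) q = cong (_ ∷_) (vertices-++ʷ p q)

  vertices≡sources∷ʳtarget : ∀ {x y} (w : Walk R x y) → vertices w ≡ sources w ∷ʳ y
  vertices≡sources∷ʳtarget here       = refl
  vertices≡sources∷ʳtarget (step r w) = cong (_ ∷_) (vertices≡sources∷ʳtarget w)

  length-vertices : ∀ {x y} (w : Walk R x y) → length (vertices w) ≡ suc (length (sources w))
  length-vertices here       = refl
  length-vertices (step r w) = cong suc (length-vertices w)

  length-vertices-++ʷʳ : ∀ {x y z} (p : Walk R x y) (q : Walk R y z) →
                         length (vertices q) ≤ length (vertices (p ++ʷ q))
  length-vertices-++ʷʳ here       q = ≤-refl
  length-vertices-++ʷʳ (step r p) q = m≤n⇒m≤1+n (length-vertices-++ʷʳ p q)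

  source∈vertices : ∀ {x y} (w : Walk R x y) → x ∈ vertices w
  source∈vertices here       = here refl
  source∈vertices (step r w) = here refl

  target∈vertices : ∀ {x y} (w : Walk R x y) → y ∈ vertices w
  target∈vertices here       = here refl
  target∈vertices (step r w) = there (target∈vertices w)

  sources⊆vertices : ∀ {x y} (w : Walk R x y) → sources w ⊆ vertices w
  sources⊆vertices (step r w) (here refl) = here refl
  sources⊆vertices (step r w) (there z∈) = there (sources⊆vertices w z∈)

  vertices-++ʷ⁺ˡ : ∀ {x y z} (p : Walk R x y) (q : Walk R y z) → vertices p ⊆ vertices (p ++ʷ q)
  vertices-++ʷ⁺ˡ here       q (here refl) = source∈vertices q
  vertices-++ʷ⁺ˡ (step r p) q (here refl) = here refl
  vertices-++ʷ⁺ˡ (step r p) q (there z∈) = there (vertices-++ʷ⁺ˡ p q z∈)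

  vertices-++ʷ⁺ʳ : ∀ {x y z} (p : Walk R x y) (q : Walk R y z) → vertices q ⊆ vertices (p ++ʷ q)
  vertices-++ʷ⁺ʳ here       q = id
  vertices-++ʷ⁺ʳ (step r p) q = there ∘ vertices-++ʷ⁺ʳ p q

  Unique-sources : ∀ {x y} (w : Walk R x y) → Unique (vertices w) → Unique (sources w)
  Unique-sources here       _         = []
  Unique-sources (step r w) (x∉ ∷ uw) = anti-mono (sources⊆vertices w) x∉ ∷ Unique-sources w uw

  Unique-++ʷ⁺ : ∀ {x y z} (p : Walk R x y) (q : Walk R y z) →
                Unique (vertices p) → Unique (vertices q) → Disjoint (sources p) (vertices q) →
                Unique (vertices (p ++ʷ q))
  Unique-++ʷ⁺ p q up uq disjoint =
    subst Unique (sym (vertices-++ʷ p q)) (++⁺ (Unique-sources p up) uq disjoint)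

  Unique-++ʷ⁻ : ∀ {x y z} (p : Walk R x y) (q : Walk R y z) →
                Unique (vertices (p ++ʷ q)) → Unique (vertices p) × Unique (vertices q)
  Unique-++ʷ⁻ here       q uq        = [] ∷ [] , uq
  Unique-++ʷ⁻ (step r p) q (x∉ ∷ u) with Unique-++ʷ⁻ p q u
  ... | up , uq = anti-mono (vertices-++ʷ⁺ˡ p q) x∉ ∷ up , uq

  linked : ∀ {x y} (w : Walk R x y) → Linked R (vertices w)
  linked here                = [-]
  linked (step r here)       = r ∷ [-]
  linked (step r (step s w)) = r ∷ linked (step s w)

  fromLinked : ∀ {x xs} → Linked R (x ∷ xs) → ∃ λ y → Σ (Walk R x y) λ w → vertices w ≡ x ∷ xs
  fromLinked [-]     = _ , here , refl
  fromLinked (r ∷ l) with fromLinked l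
  ... | y , w , vs≡ = y , step r w , cong (_ ∷_) vs≡

  closedWalk-isCycle : ∀ {x y} (r : R x y) (w : Walk R y x) →
                       Unique (vertices w) → 3 ≤ length (vertices w) → IsCycle R (x ∷ sources w)
  closedWalk-isCycle {x} r w uw long =
      subst (3 ≤_) (length-vertices w) long
    , Unique-resp-↭ (↭-sym (∷↭∷ʳ x (sources w))) (subst Unique (vertices≡sources∷ʳtarget w) uw)
    , subst (λ vs → Linked R (x ∷ vs)) (vertices≡sources∷ʳtarget w) (linked (step r w))

  record FirstHit (P : A → Set) {x y} (w : Walk R x y) : Set where
    field
      {hit}  : A
      prefix : Walk R x hit
      suffix : Walk R hit y
      splits : prefix ++ʷ suffix ≡ w
      P-hit  : P hit
      avoids : All (¬_ ∘ P) (sources prefix)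

    prefix⊆ : vertices prefix ⊆ vertices w
    prefix⊆ = subst (λ v → vertices prefix ⊆ vertices v) splits (vertices-++ʷ⁺ˡ prefix suffix)

    suffix⊆ : vertices suffix ⊆ vertices w
    suffix⊆ = subst (λ v → vertices suffix ⊆ vertices v) splits (vertices-++ʷ⁺ʳ prefix suffix)

    Unique-prefix : Unique (vertices w) → Unique (vertices prefix)
    Unique-prefix = proj₁ ∘ Unique-++ʷ⁻ prefix suffix ∘ subst (Unique ∘ vertices) (sym splits)

    Unique-suffix : Unique (vertices w) → Unique (vertices suffix)
    Unique-suffix = proj₂ ∘ Unique-++ʷ⁻ prefix suffix ∘ subst (Unique ∘ vertices) (sym splits)

    ∈-split : ∀ {z} → z ∈ vertices w → z ∈ sources prefix ⊎ z ∈ vertices suffix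
    ∈-split = ∈-++⁻ (sources prefix) ∘ subst (_ ∈_) (vertices-++ʷ prefix suffix)
            ∘ subst (λ v → _ ∈ vertices v) (sym splits)

  firstHit : ∀ {P : A → Set} {x y} → Decidable P → (w : Walk R x y) → Any P (vertices w) → FirstHit P w
  firstHit P? here (here p) = record { prefix = here ; suffix = here ; splits = refl ; P-hit = p ; avoids = [] }
  firstHit {x = x} P? (step r w) any with P? x
  ... | yes p = record { prefix = here ; suffix = step r w ; splits = refl ; P-hit = p ; avoids = [] }
  ... | no ¬p = record
    { prefix = step r prefix ; suffix = suffix ; splits = cong (step r) splits
    ; P-hit = P-hit ; avoids = ¬p ∷ avoids }
    where open FirstHit (firstHit P? w (Any.tail ¬p any))

  record SimpleWalkWithin (xs : List A) (u v : A) : Set where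
    field
      walk   : Walk R u v
      unique : Unique (vertices walk)
      within : vertices walk ⊆ xs

  weaken : ∀ {xs ys u v} → xs ⊆ ys → SimpleWalkWithin xs u v → SimpleWalkWithin ys u v
  weaken xs⊆ys s = record { walk = walk ; unique = unique ; within = xs⊆ys ∘ within }
    where open SimpleWalkWithin s

  module Reversal (R-sym : Symmetric R) where

    reverseʷ : ∀ {x y} → Walk R x y → Walk R y x
    reverseʷ here       = here
    reverseʷ (step r w) = reverseʷ w ++ʷ step (R-sym r) here

    vertices-reverseʷ : ∀ {x y} (w : Walk R x y) → vertices (reverseʷ w) ≡ reverse (vertices w)
    vertices-reverseʷ here = refl
    vertices-reverseʷ {x} (step {y = y} r w) = begin
      vertices (reverseʷ w ++ʷ step (R-sym r) here) ≡⟨ vertices-++ʷ (reverseʷ w) _ ⟩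
      sources (reverseʷ w) ++ y ∷ x ∷ []            ≡⟨ ++-assoc (sources (reverseʷ w)) _ _ ⟨
      (sources (reverseʷ w) ∷ʳ y) ∷ʳ x              ≡⟨ cong (_∷ʳ x) (vertices≡sources∷ʳtarget (reverseʷ w)) ⟨
      vertices (reverseʷ w) ∷ʳ x                    ≡⟨ cong (_∷ʳ x) (vertices-reverseʷ w) ⟩
      reverse (vertices w) ∷ʳ x                     ≡⟨ unfold-reverse x (vertices w) ⟨
      reverse (x ∷ vertices w)                      ∎
      where open ≡-Reasoning

    vertices-reverseʷ-↭ : ∀ {x y} (w : Walk R x y) → vertices (reverseʷ w) ↭ vertices w
    vertices-reverseʷ-↭ w = ↭-trans (↭-reflexive (vertices-reverseʷ w)) (↭-reverse (vertices w))

    Unique-reverseʷ : ∀ {x y} (w : Walk R x y) → Unique (vertices w) → Unique (vertices (reverseʷ w))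
    Unique-reverseʷ w = Unique-resp-↭ (↭-sym (vertices-reverseʷ-↭ w))

    vertices-reverseʷ⁻ : ∀ {x y} (w : Walk R x y) → vertices (reverseʷ w) ⊆ vertices w
    vertices-reverseʷ⁻ w = ∈-resp-↭ (vertices-reverseʷ-↭ w)

    length-vertices-reverseʷ : ∀ {x y} (w : Walk R x y) → length (vertices (reverseʷ w)) ≡ length (vertices w)
    length-vertices-reverseʷ w = xs↭ys⇒|xs|≡|ys| (vertices-reverseʷ-↭ w)

    reverse-within : ∀ {xs u v} → SimpleWalkWithin xs u v → SimpleWalkWithin xs v u
    reverse-within s = record
      { walk = reverseʷ walk ; unique = Unique-reverseʷ walk unique ; within = within ∘ vertices-reverseʷ⁻ walk }
      where open SimpleWalkWithin s

  module Segments (_≟_ : DecidableEquality A) (R-sym : Symmetric R) where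

    open Reversal R-sym

    prefixTo : ∀ {x y z} (w : Walk R x y) → Unique (vertices w) → z ∈ vertices w →
               SimpleWalkWithin (vertices w) x z
    prefixTo {z = z} w uw z∈ with firstHit (z ≟_) w (lose z∈ refl)
    ... | h@record { P-hit = refl } = record { walk = prefix ; unique = Unique-prefix uw ; within = prefix⊆ }
      where open FirstHit h

    suffixFrom : ∀ {x y z} (w : Walk R x y) → Unique (vertices w) → z ∈ vertices w →
                 SimpleWalkWithin (vertices w) z y
    suffixFrom {z = z} w uw z∈ with firstHit (z ≟_) w (lose z∈ refl)
    ... | h@record { P-hit = refl } = record { walk = suffix ; unique = Unique-suffix uw ; within = suffix⊆ }
      where open FirstHit h

    subwalk : ∀ {x y u v} (w : Walk R x y) → Unique (vertices w) → u ∈ vertices w → v ∈ vertices w →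
              SimpleWalkWithin (vertices w) u v
    subwalk {u = u} w uw u∈ v∈ with firstHit (u ≟_) w (lose u∈ refl)
    ... | h@record { P-hit = refl } =
      [ (λ v∈prefix → weaken prefix⊆ (reverse-within
                         (suffixFrom prefix (Unique-prefix uw) (sources⊆vertices prefix v∈prefix))))
      , (λ v∈suffix → weaken suffix⊆ (prefixTo suffix (Unique-suffix uw) v∈suffix))
      ]′ (∈-split v∈)
      where open FirstHit h

    path-segment : ∀ {xs u v} → IsPath R xs → u ∈ xs → v ∈ xs → SimpleWalkWithin xs u v
    path-segment {x ∷ xs} {u} {v} (xs-linked , xs-unique) u∈ v∈ with fromLinked xs-linked
    ... | _ , w , vs≡ = subst (λ ys → SimpleWalkWithin ys u v) vs≡
            (subwalk w (subst Unique (sym vs≡) xs-unique)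
                       (subst (u ∈_) (sym vs≡) u∈) (subst (v ∈_) (sym vs≡) v∈))

module Forest {A : Set} (_≟_ : DecidableEquality A) {R : A → A → Set}
              (R-sym : Symmetric R) (acyclic : ∀ p → ¬ IsCycle R p) where

  open Walks {A} {R}
  open Reversal R-sym
  open Segments _≟_ R-sym
  open SimpleWalkWithin
  open DecMembership _≟_ using (_∈?_)

  detour-collapses : ∀ {x x₁ t} → R x x₁ → (p : Walk R x₁ t) (q : Walk R x t) →
                     Unique (vertices p) → Unique (vertices q) →
                     All (_∉ vertices q) (sources p) → x ∉ vertices p → x₁ ≡ t
  detour-collapses r here q _ _ _ _ = refl
  detour-collapses r p@(step _ _) here _ _ _ x∉p = ⊥-elim (x∉p (target∈vertices p))
  detour-collapses r p@(step _ p′) q@(step _ q′) up uq p∉q _ =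
    ⊥-elim (acyclic _ (closedWalk-isCycle r (p ++ʷ reverseʷ q) cycle-unique cycle-long))
    where
    cycle-unique : Unique (vertices (p ++ʷ reverseʷ q))
    cycle-unique = Unique-++ʷ⁺ p (reverseʷ q) up (Unique-reverseʷ q uq)
                     (λ (v∈p , v∈q) → All.lookup p∉q v∈p (vertices-reverseʷ⁻ q v∈q))

    cycle-long : 3 ≤ length (vertices (p ++ʷ reverseʷ q))
    cycle-long = s≤s (begin
      2                                      ≤⟨ s≤s (s≤s z≤n) ⟩
      suc (suc (length (sources q′)))        ≡⟨ cong suc (length-vertices q′) ⟨
      length (vertices q)                    ≡⟨ length-vertices-reverseʷ q ⟨
      length (vertices (reverseʷ q))         ≤⟨ length-vertices-++ʷʳ p′ (reverseʷ q) ⟩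
      length (vertices (p′ ++ʷ reverseʷ q))  ∎)
      where open ≤-Reasoning

  second-vertex∈ : ∀ {x x₁ y} (r : R x x₁) (p : Walk R x₁ y) (q : Walk R x y) →
                   Unique (vertices (step r p)) → Unique (vertices q) → x₁ ∈ vertices q
  second-vertex∈ {x} {x₁} r p q (x∉p ∷ up) uq = subst (_∈ vertices q) (sym x₁≡hit) P-hit
    where
    open FirstHit (firstHit (_∈? vertices q) p (lose (target∈vertices p) (target∈vertices q)))
    q₁ : SimpleWalkWithin (vertices q) x hit
    q₁ = prefixTo q uq P-hit
    x₁≡hit : x₁ ≡ hit
    x₁≡hit = detour-collapses r prefix (walk q₁) (Unique-prefix up) (unique q₁)
               (All.map (_∘ within q₁) avoids) (λ x∈prefix → All.lookup x∉p (prefix⊆ x∈prefix) refl)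

  simpleWalk-vertices-⊆ : ∀ {x y} (p q : Walk R x y) → Unique (vertices p) → Unique (vertices q) →
                          vertices p ⊆ vertices q
  simpleWalk-vertices-⊆ here       q _ _ (here refl) = source∈vertices q
  simpleWalk-vertices-⊆ (step r p) q _ _ (here refl) = source∈vertices q
  simpleWalk-vertices-⊆ {y = y} (step {y = x₁} r p) q up@(_ ∷ up′) uq (there z∈p) =
    within q₁ (simpleWalk-vertices-⊆ p (walk q₁) up′ (unique q₁) z∈p)
    where
    q₁ : SimpleWalkWithin (vertices q) x₁ y
    q₁ = suffixFrom q uq (second-vertex∈ r p q up uq)

  paths-helly : ∀ {as bs cs x y z} → IsPath R as → IsPath R bs → IsPath R cs →
                x ∈ as → x ∈ bs → y ∈ bs → y ∈ cs → z ∈ as → z ∈ cs →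
                ∃ λ t → t ∈ as × t ∈ bs × t ∈ cs
  paths-helly {as} {bs} {cs} {x} {y} {z} pa pb pc x∈a x∈b y∈b y∈c z∈a z∈c =
    hit , P-hit , within yx (simpleWalk-vertices-⊆ y→x (walk yx) y→x-unique (unique yx) hit∈y→x)
        , within yz (prefix⊆ (target∈vertices prefix))
    where
    yz : SimpleWalkWithin cs y z
    yz = path-segment pc y∈c z∈c
    yx : SimpleWalkWithin bs y x
    yx = path-segment pb y∈b x∈b
    open FirstHit (firstHit (_∈? as) (walk yz) (lose (target∈vertices (walk yz)) z∈a))
    tx : SimpleWalkWithin as hit x
    tx = path-segment pa P-hit x∈a
    y→x : Walk R y x
    y→x = prefix ++ʷ walk tx
    y→x-unique : Unique (vertices y→x)
    y→x-unique = Unique-++ʷ⁺ prefix (walk tx) (Unique-prefix (unique yz)) (unique tx)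
                   (λ (v∈prefix , v∈tx) → All.lookup avoids v∈prefix (within tx v∈tx))
    hit∈y→x : hit ∈ vertices y→x
    hit∈y→x = vertices-++ʷ⁺ʳ prefix (walk tx) (source∈vertices (walk tx))

module _ (G : TPIG) where

  open TPIG G

  module TV = Forest _≟_ (λ {x} {y} → subst T (IsTree.symmetric TV-tree x y)) (IsTree.acyclic TV-tree)

  RIndependent⇒¬CommonGuard : ∀ {h₁ v₁ h₂ v₂} → RIndependent G h₁ v₁ h₂ v₂ → ¬ CommonGuard G h₁ v₁ h₂ v₂
  RIndependent⇒¬CommonGuard (inj₁ ¬sharedV) (_ , v , _ , (_ , h₁v) , (_ , h₂v)) = ¬sharedV (v , h₁v , h₂v)
  RIndependent⇒¬CommonGuard (inj₂ ¬sharedH) (h , _ , _ , (hv₁ , _) , (hv₂ , _)) = ¬sharedH (h , hv₁ , hv₂)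

  sharedNeighbours⇒CommonGuard : ∀ {h₀ h₁ h₂ v₀ v₁ v₂} → Edge G h₁ v₁ → Edge G h₂ v₂ →
                                 Edge G h₁ v₀ → Edge G h₂ v₀ → Edge G h₀ v₁ → Edge G h₀ v₂ →
                                 CommonGuard G h₁ v₁ h₂ v₂
  sharedNeighbours⇒CommonGuard {h₀} {h₁} {h₂} {v₀} {v₁} {v₂} h₁v₁ h₂v₂ h₁v₀ h₂v₀ h₀v₁ h₀v₂
    with ΓH-path h₀ | ΓH-path h₁ | ΓH-path h₂
  ... | Γ₀ , Γ₀-path , Γ₀≈ | Γ₁ , Γ₁-path , Γ₁≈ | Γ₂ , Γ₂-path , Γ₂≈
    with TV.paths-helly Γ₀-path Γ₁-path Γ₂-path
           (proj₁ (Γ₀≈ v₁) h₀v₁) (proj₁ (Γ₁≈ v₁) h₁v₁) (proj₁ (Γ₁≈ v₀) h₁v₀)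
           (proj₁ (Γ₂≈ v₀) h₂v₀) (proj₁ (Γ₀≈ v₂) h₀v₂) (proj₁ (Γ₂≈ v₂) h₂v₂)
  ... | t , t∈Γ₀ , t∈Γ₁ , t∈Γ₂ =
    h₀ , t , proj₂ (Γ₀≈ t) t∈Γ₀ , (h₀v₁ , proj₂ (Γ₁≈ t) t∈Γ₁) , (h₀v₂ , proj₂ (Γ₂≈ t) t∈Γ₂)

  RIndependent⊎CommonGuard : ∀ {h₁ v₁ h₂ v₂} → Edge G h₁ v₁ → Edge G h₂ v₂ →
                             RIndependent G h₁ v₁ h₂ v₂ ⊎ CommonGuard G h₁ v₁ h₂ v₂
  RIndependent⊎CommonGuard {h₁} {v₁} {h₂} {v₂} h₁v₁ h₂v₂
    with any? (λ v → T? (E h₁ v) ×-dec T? (E h₂ v)) | any? (λ h → T? (E h v₁) ×-dec T? (E h v₂))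
  ... | no ¬sharedV             | _                       = inj₁ (inj₁ ¬sharedV)
  ... | yes _                   | no ¬sharedH             = inj₁ (inj₂ ¬sharedH)
  ... | yes (v₀ , h₁v₀ , h₂v₀) | yes (h₀ , h₀v₁ , h₀v₂) =
    inj₂ (sharedNeighbours⇒CommonGuard h₁v₁ h₂v₂ h₁v₀ h₂v₀ h₀v₁ h₀v₂)

lemma19 : (G : TPIG) → ∀ (h₁ : Fin (TPIG.m G)) (v₁ : Fin (TPIG.n G)) (h₂ : Fin (TPIG.m G)) (v₂ : Fin (TPIG.n G)) →
            Edge G h₁ v₁ → Edge G h₂ v₂ →
            (RIndependent G h₁ v₁ h₂ v₂ → ¬ CommonGuard G h₁ v₁ h₂ v₂) ×
            (¬ CommonGuard G h₁ v₁ h₂ v₂ → RIndependent G h₁ v₁ h₂ v₂)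
lemma19 G h₁ v₁ h₂ v₂ h₁v₁ h₂v₂ =
    RIndependent⇒¬CommonGuard G
  , λ ¬guard → [ id , ⊥-elim ∘ ¬guard ]′ (RIndependent⊎CommonGuard G h₁v₁ h₂v₂)
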